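{- Let $p$ be a prime with $p\equiv3\pmod4$ and $n_0=\frac{p^2-1}{2}$. Let $(n,k)$ be integers with $1\le k\le n_0<n$, and let $\lambda$ be an unordered partition of $2n$ into $2k$ parts, all parts odd, all parts less than $p^2$, and no part equal to $p$. Writing $c_i$ for the number of parts of $\lambda$ equal to $i$ ($1\le i\le 2n$), $$\omega_p\!\left(\frac{(2n)!}{\prod_{i=1}^{2n} i!^{c_i}\,c_i!}\right)>0.$$
   Context: $\omega_p(x)$ denotes the $p$-adic valuation of a positive integer $x$ (the largest $\alpha$ with $p^\alpha\mid x$); the quantity $\frac{(2n)!}{\prod_i i!^{c_i}c_i!}$ is a positive integer. -}

module Defs where

open import Data.Nat using (ℕ; zero; suc; _+_; _*_; _^_; _!; _≡ᵇ_; _∸_; _/_)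
open import Data.Bool using (if_then_else_)
open import Data.List using (List; []; _∷_)

count : ℕ → List ℕ → ℕ
count i [] = 0
count i (x ∷ xs) = if x ≡ᵇ i then suc (count i xs) else count i xs

prodFrom1 : ℕ → (ℕ → ℕ) → ℕ
prodFrom1 zero f = 1
prodFrom1 (suc m) f = prodFrom1 m f * f (suc m)

denom : ℕ → List ℕ → ℕ
denom n λs = prodFrom1 (2 * n) (λ i → ((i !) ^ count i λs) * (count i λs !))

n₀ : ℕ → ℕ
n₀ p = (p ^ 2 ∸ 1) / 2

{-# OPTIONS --safe #-}
-- All parts and all multiplicities c_i (at most 2k ≤ 2n₀) are below p², so Legendre's formula
-- gives the p-adic valuation of the denominator exactly: Σ_i (c_i ⌊i/p⌋ + ⌊c_i/p⌋). For a part i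
-- not divisible by p the remainder i mod p ≥ 1 pays for ⌊c_i/p⌋, so p times its term is at most
-- c_i i; a part divisible by p is at least 2p, as no part equals p, so its ⌊c_i/p⌋ is at most
-- c_i i / 2p². Since Σ c_i i = 2n ≥ p², the total is below ⌊2n/p⌋ + ⌊2n/p²⌋ ≤ ω_p((2n)!).
module Submission where

open import Defs
open import Data.Nat using (ℕ; _+_; _*_; _∸_; _^_; _≤_; _<_; _!; _%_)
open import Data.Nat.Divisibility using (_∣_)
open import Data.Nat.Primality using (Prime)
open import Data.List using (List; length)
open import Data.Nat.ListAction using (sum)
open import Data.List.Relation.Unary.All using (All)
open import Data.Product using (∃; _×_)
open import Relation.Binary.PropositionalEquality using (_≡_; _≢_)

open import Data.Bool using (true; false; if_then_else_)
open import Data.Empty using (⊥-elim)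
open import Data.List using ([]; _∷_)
open import Data.List.Relation.Unary.All using ([]; _∷_)
open import Data.Nat
  using (zero; suc; pred; _/_; _≡ᵇ_; s≤s; z≤n; z<s;
         NonZero; ≢-nonZero; >-nonZero; >-nonZero⁻¹; nonTrivial⇒n>1)
open import Data.Nat.Divisibility
  using (divides; _∣?_; ∣-refl; ∣-trans; *-pres-∣; *-monoʳ-∣; *-monoˡ-∣; *-cancelˡ-∣;
         ∣m+n∣m⇒∣n; ∣⇒≤; m∣m*n; n∣m*n; m≤n⇒m!∣n!; m%n≡0⇒n∣m; module ∣-Reasoning)
open import Data.Nat.DivMod
open import Data.Nat.Combinatorics using (k![n∸k]!∣n!)
open import Data.Nat.Primality using (euclidsLemma; prime⇒nonZero; prime⇒nonTrivial)
open import Data.Nat.Properties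
open import Algebra.Properties.CommutativeSemigroup +-commutativeSemigroup
  using () renaming (interchange to +-interchange)
open import Algebra.Properties.CommutativeSemigroup *-commutativeSemigroup
  using () renaming (interchange to *-interchange; x∙yz≈y∙xz to *-left-commute)
open import Data.Nat.Tactic.RingSolver using (solve-∀)
open import Data.Product using (_,_; proj₁; proj₂)
open import Data.Sum using (inj₁; inj₂)
open import Relation.Nullary using (¬_; yes; no)
open import Relation.Binary.PropositionalEquality
  using (refl; sym; trans; cong; cong₂; subst; module ≡-Reasoning)

sumFrom1 : ℕ → (ℕ → ℕ) → ℕ
sumFrom1 zero f = 0
sumFrom1 (suc m) f = sumFrom1 m f + f (suc m)

sumFrom1-cong : ∀ m {f g} → (∀ i → f i ≡ g i) → sumFrom1 m f ≡ sumFrom1 m g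
sumFrom1-cong zero f≡g = refl
sumFrom1-cong (suc m) f≡g = cong₂ _+_ (sumFrom1-cong m f≡g) (f≡g (suc m))

sumFrom1-mono-≤ : ∀ m {f g} → (∀ i → f i ≤ g i) → sumFrom1 m f ≤ sumFrom1 m g
sumFrom1-mono-≤ zero f≤g = z≤n
sumFrom1-mono-≤ (suc m) f≤g = +-mono-≤ (sumFrom1-mono-≤ m f≤g) (f≤g (suc m))

sumFrom1-+ : ∀ m f g → sumFrom1 m (λ i → f i + g i) ≡ sumFrom1 m f + sumFrom1 m g
sumFrom1-+ zero f g = refl
sumFrom1-+ (suc m) f g = begin
  sumFrom1 m (λ i → f i + g i) + (f (suc m) + g (suc m))
    ≡⟨ cong (_+ (f (suc m) + g (suc m))) (sumFrom1-+ m f g) ⟩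
  sumFrom1 m f + sumFrom1 m g + (f (suc m) + g (suc m))
    ≡⟨ +-interchange (sumFrom1 m f) (sumFrom1 m g) (f (suc m)) (g (suc m)) ⟩
  sumFrom1 m f + f (suc m) + (sumFrom1 m g + g (suc m)) ∎
  where open ≡-Reasoning

*-distribˡ-sumFrom1 : ∀ k m f → k * sumFrom1 m f ≡ sumFrom1 m (λ i → k * f i)
*-distribˡ-sumFrom1 k zero f = *-zeroʳ k
*-distribˡ-sumFrom1 k (suc m) f =
  trans (*-distribˡ-+ k _ _) (cong (_+ k * f (suc m)) (*-distribˡ-sumFrom1 k m f))

m!*n!∣[m+n]! : ∀ m n → m ! * n ! ∣ (m + n) !
m!*n!∣[m+n]! m n = subst (λ x → m ! * x ! ∣ (m + n) !) (m+n∸m≡n m n) (k![n∸k]!∣n! (m≤m+n m n))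

m<n⇒n*m!∣n! : ∀ {m n} → m < n → n * m ! ∣ n !
m<n⇒n*m!∣n! {n = suc n} (s≤s m≤n) = *-monoʳ-∣ (suc n) (m≤n⇒m!∣n! m≤n)

-- The quotient counts the partitions of a set of size c(i+1) into blocks of size i+1; the
-- induction step chooses the block of the last element, as C(c(i+1)+i, i) times a smaller count.
[i!]^c*c!∣[c*i]! : ∀ i c → (suc i !) ^ c * c ! ∣ (c * suc i) !
[i!]^c*c!∣[c*i]! i zero = ∣-refl
[i!]^c*c!∣[c*i]! i (suc c) = begin
  (suc i !) ^ suc c * suc c !
    ≡⟨ regroup (suc i) (i !) ((suc i !) ^ c) (suc c) (c !) ⟩
  suc c * suc i * ((suc i !) ^ c * c ! * i !)
    ∣⟨ *-monoʳ-∣ (suc c * suc i)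
         (∣-trans (*-monoˡ-∣ (i !) ([i!]^c*c!∣[c*i]! i c)) (m!*n!∣[m+n]! (c * suc i) i)) ⟩
  suc c * suc i * (c * suc i + i) !
    ≡⟨ cong (λ x → suc c * suc i * x !) (+-comm (c * suc i) i) ⟩
  (suc c * suc i) ! ∎
  where
  open ∣-Reasoning
  regroup : ∀ j f g c h → j * f * g * (c * h) ≡ c * j * (g * h * f)
  regroup = solve-∀

denominator : (ℕ → ℕ) → ℕ → ℕ
denominator c m = prodFrom1 m (λ i → (i !) ^ c i * c i !)

denominator∣multinomial : ∀ c m → denominator c m ∣ (sumFrom1 m (λ i → c i * i)) !
denominator∣multinomial c zero = ∣-refl
denominator∣multinomial c (suc m) =
  ∣-trans (*-pres-∣ (denominator∣multinomial c m) ([i!]^c*c!∣[c*i]! m (c (suc m))))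
          (m!*n!∣[m+n]! (sumFrom1 m (λ i → c i * i)) (c (suc m) * suc m))

count≤length : ∀ i xs → count i xs ≤ length xs
count≤length i [] = z≤n
count≤length i (x ∷ xs) with x ≡ᵇ i
... | true = s≤s (count≤length i xs)
... | false = m≤n⇒m≤1+n (count≤length i xs)

count≢0⇒All : ∀ {P : ℕ → Set} i xs → All P xs → count i xs ≢ 0 → P i
count≢0⇒All i [] [] count≢0 = ⊥-elim (count≢0 refl)
count≢0⇒All {P} i (x ∷ xs) (px ∷ pxs) count≢0 with x ≡ᵇ i | ≡ᵇ⇒≡ x i
... | true | x≡i = subst P (x≡i _) px
... | false | _ = count≢0⇒All i xs pxs count≢0

occurrence : ℕ → ℕ → ℕ
occurrence x i = if x ≡ᵇ i then i else 0

sumFrom1-occurrence-below : ∀ x m → m < x → sumFrom1 m (occurrence x) ≡ 0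
sumFrom1-occurrence-below x zero m<x = refl
sumFrom1-occurrence-below x (suc m) m<x with x ≡ᵇ suc m | ≡ᵇ⇒≡ x (suc m)
... | true | x≡ = ⊥-elim (<-irrefl (sym (x≡ _)) m<x)
... | false | _ = trans (+-identityʳ _) (sumFrom1-occurrence-below x m (<-trans (n<1+n m) m<x))

sumFrom1-occurrence≤ : ∀ x m → sumFrom1 m (occurrence x) ≤ x
sumFrom1-occurrence≤ x zero = z≤n
sumFrom1-occurrence≤ x (suc m) with x ≡ᵇ suc m | ≡ᵇ⇒≡ x (suc m)
... | true | x≡ = ≤-reflexive (begin
  sumFrom1 m (occurrence x) + suc m
    ≡⟨ cong (_+ suc m) (sumFrom1-occurrence-below x m (subst (m <_) (sym (x≡ _)) (n<1+n m))) ⟩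
  suc m
    ≡⟨ x≡ _ ⟨
  x ∎)
  where open ≡-Reasoning
... | false | _ = subst (_≤ x) (sym (+-identityʳ _)) (sumFrom1-occurrence≤ x m)

count-∷ : ∀ i x xs → count i (x ∷ xs) * i ≡ count i xs * i + occurrence x i
count-∷ i x xs with x ≡ᵇ i
... | true = +-comm i (count i xs * i)
... | false = sym (+-identityʳ _)

sumFrom1-count≤sum : ∀ m xs → sumFrom1 m (λ i → count i xs * i) ≤ sum xs
sumFrom1-count≤sum m [] = ≤-reflexive (sumFrom1-zero m)
  where
  sumFrom1-zero : ∀ m → sumFrom1 m (λ _ → 0) ≡ 0
  sumFrom1-zero zero = refl
  sumFrom1-zero (suc m) = trans (+-identityʳ _) (sumFrom1-zero m)
sumFrom1-count≤sum m (x ∷ xs) = begin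
  sumFrom1 m (λ i → count i (x ∷ xs) * i)
    ≡⟨ sumFrom1-cong m (λ i → count-∷ i x xs) ⟩
  sumFrom1 m (λ i → count i xs * i + occurrence x i)
    ≡⟨ sumFrom1-+ m (λ i → count i xs * i) (occurrence x) ⟩
  sumFrom1 m (λ i → count i xs * i) + sumFrom1 m (occurrence x)
    ≤⟨ +-mono-≤ (sumFrom1-count≤sum m xs) (sumFrom1-occurrence≤ x m) ⟩
  sum xs + x
    ≡⟨ +-comm (sum xs) x ⟩
  x + sum xs ∎
  where open ≤-Reasoning

m≤n⇒o^m∣o^n : ∀ o {m n} → m ≤ n → o ^ m ∣ o ^ n
m≤n⇒o^m∣o^n o {m} {n} m≤n = subst (λ k → o ^ m ∣ o ^ k) (m+[n∸m]≡n m≤n)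
  (subst (o ^ m ∣_) (sym (^-distribˡ-+-* o m (n ∸ m))) (m∣m*n (o ^ (n ∸ m))))

2*m*t≤n⇒m≤n⇒[1+t]*m≤n : ∀ t m n → 2 * m * t ≤ n → m ≤ n → suc t * m ≤ n
2*m*t≤n⇒m≤n⇒[1+t]*m≤n zero m n _ m≤n = subst (_≤ n) (sym (+-identityʳ m)) m≤n
2*m*t≤n⇒m≤n⇒[1+t]*m≤n (suc t) m n 2mt≤n _ = begin
  suc (suc t) * m                 ≤⟨ m≤m+n (suc (suc t) * m) (t * m) ⟩
  suc (suc t) * m + t * m         ≡⟨ split m t ⟨
  2 * m * suc t                   ≤⟨ 2mt≤n ⟩
  n                               ∎
  where
  open ≤-Reasoning
  split : ∀ m t → 2 * m * suc t ≡ suc (suc t) * m + t * m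
  split = solve-∀

m<[1+m/d]*d : ∀ m d .{{_ : NonZero d}} → m < suc (m / d) * d
m<[1+m/d]*d m d = begin-strict
  m                  ≡⟨ m≡m%n+[m/n]*n m d ⟩
  m % d + m / d * d  <⟨ +-monoˡ-< (m / d * d) (m%n<n m d) ⟩
  d + m / d * d      ∎
  where open ≤-Reasoning

module PrimeValuation {p : ℕ} (p-prime : Prime p) where

  instance
    p≢0 : NonZero p
    p≢0 = prime⇒nonZero p-prime

  record Valuation (x a : ℕ) : Set where
    constructor valuation
    field
      unit : ℕ
      factorisation : x ≡ p ^ a * unit
      p∤unit : ¬ p ∣ unit

  0<m<p⇒p∤m : ∀ {m} → 0 < m → m < p → ¬ p ∣ m
  0<m<p⇒p∤m 0<m m<p p∣m = <⇒≱ m<p (∣⇒≤ {{>-nonZero 0<m}} p∣m)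

  p∤⇒valuation-0 : ∀ {m} → ¬ p ∣ m → Valuation m 0
  p∤⇒valuation-0 {m} p∤m = valuation m (sym (*-identityˡ m)) p∤m

  valuation-1 : Valuation 1 0
  valuation-1 = p∤⇒valuation-0 (0<m<p⇒p∤m z<s (nonTrivial⇒n>1 p {{prime⇒nonTrivial p-prime}}))

  valuation-* : ∀ {x y a b} → Valuation x a → Valuation y b → Valuation (x * y) (a + b)
  valuation-* {x} {y} {a} {b} (valuation u x≡ p∤u) (valuation v y≡ p∤v) =
    valuation (u * v) x*y≡ p∤u*v
    where
    x*y≡ : x * y ≡ p ^ (a + b) * (u * v)
    x*y≡ = begin
      x * y                     ≡⟨ cong₂ _*_ x≡ y≡ ⟩
      p ^ a * u * (p ^ b * v)   ≡⟨ *-interchange (p ^ a) u (p ^ b) v ⟩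
      p ^ a * p ^ b * (u * v)   ≡⟨ cong (_* (u * v)) (^-distribˡ-+-* p a b) ⟨
      p ^ (a + b) * (u * v)     ∎
      where open ≡-Reasoning
    p∤u*v : ¬ p ∣ u * v
    p∤u*v p∣u*v with euclidsLemma u v p-prime p∣u*v
    ... | inj₁ p∣u = p∤u p∣u
    ... | inj₂ p∣v = p∤v p∣v

  valuation-^ : ∀ {x a} → Valuation x a → ∀ c → Valuation (x ^ c) (c * a)
  valuation-^ v zero = valuation-1
  valuation-^ v (suc c) = valuation-* v (valuation-^ v c)

  valuation-prodFrom1 : ∀ {f g} → (∀ i → Valuation (f i) (g i)) →
                        ∀ m → Valuation (prodFrom1 m f) (sumFrom1 m g)
  valuation-prodFrom1 v zero = valuation-1
  valuation-prodFrom1 v (suc m) = valuation-* (valuation-prodFrom1 v m) (v (suc m))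

  valuation-! : ∀ m → m < p * p → Valuation (m !) (m / p)
  valuation-! m m<p² = subst (λ x → Valuation (x !) (m / p)) (sym (m≡m%n+[m/n]*n m p))
    (digits (m / p) (m % p) (m<n*o⇒m/o<n m<p²) (m%n<n m p))
    where
    digits : ∀ q r → q < p → r < p → Valuation ((r + q * p) !) q
    digits zero zero _ _ = valuation-1
    digits q (suc r) q<p 1+r<p =
      valuation-* (p∤⇒valuation-0 p∤) (digits q r q<p (<-trans (n<1+n r) 1+r<p))
      where
      p∤ : ¬ p ∣ suc r + q * p
      p∤ p∣ = 0<m<p⇒p∤m z<s 1+r<p
        (∣m+n∣m⇒∣n (subst (p ∣_) (+-comm (suc r) (q * p)) p∣) (n∣m*n q))
    -- Writing p as suc (pred p) makes (p + q p)! unfold to (p + q p) · (pred p + q p)!.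
    digits (suc q) zero 1+q<p _ =
      subst (λ x → Valuation ((x + q * p) !) (suc q)) (suc-pred p)
        (valuation-* multiple (digits q (pred p) (<-trans (n<1+n q) 1+q<p) pred[p]<p))
      where
      pred[p]<p : pred p < p
      pred[p]<p = subst (pred p <_) (suc-pred p) (n<1+n (pred p))
      multiple : Valuation (suc (pred p) + q * p) 1
      multiple = valuation (suc q) (begin
        suc (pred p) + q * p ≡⟨ cong (_+ q * p) (suc-pred p) ⟩
        p + q * p            ≡⟨ cong (p +_) (*-comm q p) ⟩
        p + p * q            ≡⟨ *-suc p q ⟨
        p * suc q            ≡⟨ cong (_* suc q) (*-identityʳ p) ⟨
        p ^ 1 * suc q        ∎)
        (0<m<p⇒p∤m z<s 1+q<p)
        where open ≡-Reasoning

  p^q*q!∣[q*p]! : ∀ q → p ^ q * q ! ∣ (q * p) !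
  p^q*q!∣[q*p]! zero = ∣-refl
  p^q*q!∣[q*p]! (suc q) = begin
    p ^ suc q * suc q !          ≡⟨ regroup p (p ^ q) q (q !) ⟩
    suc q * p * (p ^ q * q !)    ∣⟨ *-monoʳ-∣ (suc q * p) (p^q*q!∣[q*p]! q) ⟩
    suc q * p * (q * p) !        ∣⟨ m<n⇒n*m!∣n! (m<n+m (q * p) (>-nonZero⁻¹ p)) ⟩
    (suc q * p) !                ∎
    where
    open ∣-Reasoning
    regroup : ∀ p a q f → p * a * (suc q * f) ≡ suc q * p * (a * f)
    regroup = solve-∀

  -- The first two terms of Legendre's formula, each under-approximated.
  p^[q+r]∣N! : ∀ {q r N} → q * p ≤ N → r * p ≤ q → p ^ (q + r) ∣ N !
  p^[q+r]∣N! {q} {r} {N} q*p≤N r*p≤q = begin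
    p ^ (q + r)        ≡⟨ ^-distribˡ-+-* p q r ⟩
    p ^ q * p ^ r      ∣⟨ *-monoʳ-∣ (p ^ q) p^r∣q! ⟩
    p ^ q * q !        ∣⟨ p^q*q!∣[q*p]! q ⟩
    (q * p) !          ∣⟨ m≤n⇒m!∣n! q*p≤N ⟩
    N !                ∎
    where
    open ∣-Reasoning
    p^r∣q! : p ^ r ∣ q !
    p^r∣q! = ∣-trans (m∣m*n (r !)) (∣-trans (p^q*q!∣[q*p]! r) (m≤n⇒m!∣n! r*p≤q))

  p∣cofactor : ∀ {x q y a e} → x ≡ q * y → Valuation y a → a < e → p ^ e ∣ x → p ∣ q
  p∣cofactor {x} {q} {y} {a} {e} x≡q*y (valuation u y≡ p∤u) a<e p^e∣x
    with euclidsLemma q u p-prime p∣q*u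
    where
    p∣q*u : p ∣ q * u
    p∣q*u = *-cancelˡ-∣ (p ^ a) {{m^n≢0 p a}} (begin
      p ^ a * p          ≡⟨ *-comm (p ^ a) p ⟩
      p ^ suc a          ∣⟨ m≤n⇒o^m∣o^n p a<e ⟩
      p ^ e              ∣⟨ p^e∣x ⟩
      x                  ≡⟨ x≡q*y ⟩
      q * y              ≡⟨ cong (q *_) y≡ ⟩
      q * (p ^ a * u)    ≡⟨ *-left-commute q (p ^ a) u ⟩
      p ^ a * (q * u)    ∎)
      where open ∣-Reasoning
  ... | inj₁ p∣q = p∣q
  ... | inj₂ p∣u = ⊥-elim (p∤u p∣u)

  valuation-i!^c*c! : ∀ i c → (c ≢ 0 → i < p * p) → c < p * p →
                      Valuation ((i !) ^ c * c !) (c * (i / p) + c / p)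
  valuation-i!^c*c! i zero _ _ = subst (Valuation 1) (sym (0/n≡0 p)) valuation-1
  valuation-i!^c*c! i c@(suc _) i<p² c<p² =
    valuation-* (valuation-^ (valuation-! i (i<p² (λ ()))) c) (valuation-! c c<p²)

  bulk tail : ℕ → ℕ → ℕ
  bulk i c with p ∣? i
  ... | yes _ = c * (i / p)
  ... | no _ = c * (i / p) + c / p
  tail i c with p ∣? i
  ... | yes _ = c / p
  ... | no _ = 0

  bulk+tail≡exponent : ∀ i c → bulk i c + tail i c ≡ c * (i / p) + c / p
  bulk+tail≡exponent i c with p ∣? i
  ... | yes _ = refl
  ... | no _ = +-identityʳ _

  p*[c*a]≡c*[a*p] : ∀ c a → p * (c * a) ≡ c * (a * p)
  p*[c*a]≡c*[a*p] c a = trans (*-left-commute p c a) (cong (c *_) (*-comm p a))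

  p*bulk≤c*i : ∀ i c → p * bulk i c ≤ c * i
  p*bulk≤c*i i c with p ∣? i
  ... | yes _ = begin
    p * (c * (i / p))    ≡⟨ p*[c*a]≡c*[a*p] c (i / p) ⟩
    c * (i / p * p)      ≤⟨ *-monoʳ-≤ c (m/n*n≤m i p) ⟩
    c * i                ∎
    where open ≤-Reasoning
  ... | no p∤i = begin
    p * (c * (i / p) + c / p)          ≡⟨ *-distribˡ-+ p (c * (i / p)) (c / p) ⟩
    p * (c * (i / p)) + p * (c / p)    ≡⟨ cong₂ _+_ (p*[c*a]≡c*[a*p] c (i / p)) (*-comm p (c / p)) ⟩
    c * (i / p * p) + c / p * p        ≤⟨ +-monoʳ-≤ (c * (i / p * p)) (m/n*n≤m c p) ⟩
    c * (i / p * p) + c                ≤⟨ +-monoʳ-≤ (c * (i / p * p)) (m≤m*n c (i % p) {{i%p≢0}}) ⟩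
    c * (i / p * p) + c * (i % p)      ≡⟨ +-comm (c * (i / p * p)) (c * (i % p)) ⟩
    c * (i % p) + c * (i / p * p)      ≡⟨ *-distribˡ-+ c (i % p) (i / p * p) ⟨
    c * (i % p + i / p * p)            ≡⟨ cong (c *_) (m≡m%n+[m/n]*n i p) ⟨
    c * i                              ∎
    where
    open ≤-Reasoning
    i%p≢0 : NonZero (i % p)
    i%p≢0 = ≢-nonZero (λ i%p≡0 → p∤i (m%n≡0⇒n∣m i p i%p≡0))

  2p≤multiple : ∀ {i} a → i ≡ a * p → i ≢ 0 → i ≢ p → 2 * p ≤ i
  2p≤multiple zero i≡0 i≢0 _ = ⊥-elim (i≢0 i≡0)
  2p≤multiple (suc zero) i≡p _ i≢p = ⊥-elim (i≢p (trans i≡p (+-identityʳ p)))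
  2p≤multiple (suc (suc a)) i≡ _ _ =
    subst (2 * p ≤_) (sym i≡) (*-monoˡ-≤ p {2} {suc (suc a)} (s≤s (s≤s z≤n)))

  2p²*tail≤c*i : ∀ i c → (c ≢ 0 → i ≢ 0 × i ≢ p) → 2 * (p * p) * tail i c ≤ c * i
  2p²*tail≤c*i i c adm with p ∣? i
  ... | yes (divides a i≡a*p) = begin
    2 * (p * p) * (c / p)    ≡⟨ regroup p (c / p) ⟩
    c / p * p * (2 * p)      ≤⟨ *-monoˡ-≤ (2 * p) (m/n*n≤m c p) ⟩
    c * (2 * p)              ≤⟨ c*2p≤c*i c adm ⟩
    c * i                    ∎
    where
    open ≤-Reasoning
    regroup : ∀ p b → 2 * (p * p) * b ≡ b * p * (2 * p)
    regroup = solve-∀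
    c*2p≤c*i : ∀ c → (c ≢ 0 → i ≢ 0 × i ≢ p) → c * (2 * p) ≤ c * i
    c*2p≤c*i zero _ = z≤n
    c*2p≤c*i c@(suc _) adm =
      *-monoʳ-≤ c (2p≤multiple a i≡a*p (proj₁ (adm (λ ()))) (proj₂ (adm (λ ()))))
  ... | no _ = subst (_≤ c * i) (sym (*-zeroʳ (2 * (p * p)))) z≤n

  p∣N!/denominator : ∀ c m N → (∀ i → c i < p * p) →
    (∀ i → c i ≢ 0 → i ≢ 0 × i ≢ p × i < p * p) →
    sumFrom1 m (λ i → c i * i) ≤ N → p * p ≤ N →
    ∃ λ q → N ! ≡ q * denominator c m × p ∣ q
  p∣N!/denominator c m N c<p² admissible Σci*i≤N p²≤N
    with ∣-trans (denominator∣multinomial c m) (m≤n⇒m!∣n! Σci*i≤N)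
  ... | divides q N!≡q*D = q , N!≡q*D , p∣cofactor N!≡q*D valuation-D B+T<N/p+1+T p^[N/p+1+T]∣N!
    where
    B T : ℕ
    B = sumFrom1 m (λ i → bulk i (c i))
    T = sumFrom1 m (λ i → tail i (c i))

    valuation-D : Valuation (denominator c m) (B + T)
    valuation-D = subst (Valuation (denominator c m)) (sumFrom1-+ m _ _)
      (valuation-prodFrom1 (λ i → subst (Valuation _) (sym (bulk+tail≡exponent i (c i)))
        (valuation-i!^c*c! i (c i) (λ ci≢0 → proj₂ (proj₂ (admissible i ci≢0))) (c<p² i))) m)

    ≤Σci*i : ∀ k {f} → (∀ i → k * f i ≤ c i * i) → k * sumFrom1 m f ≤ N
    ≤Σci*i k {f} k*f≤ = begin
      k * sumFrom1 m f             ≡⟨ *-distribˡ-sumFrom1 k m f ⟩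
      sumFrom1 m (λ i → k * f i)   ≤⟨ sumFrom1-mono-≤ m k*f≤ ⟩
      sumFrom1 m (λ i → c i * i)   ≤⟨ Σci*i≤N ⟩
      N                            ∎
      where open ≤-Reasoning

    B≤N/p : B ≤ N / p
    B≤N/p = subst (_≤ N / p) (m*n/n≡m B p)
      (/-monoˡ-≤ p (subst (_≤ N) (*-comm p B) (≤Σci*i p (λ i → p*bulk≤c*i i (c i)))))

    [1+T]*p*p≤N : suc T * p * p ≤ N
    [1+T]*p*p≤N = subst (_≤ N) (sym (*-assoc (suc T) p p))
      (2*m*t≤n⇒m≤n⇒[1+t]*m≤n T (p * p) N
        (≤Σci*i (2 * (p * p)) (λ i → 2p²*tail≤c*i i (c i) (λ ci≢0 →
          proj₁ (admissible i ci≢0) , proj₁ (proj₂ (admissible i ci≢0)))))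
        p²≤N)

    p^[N/p+1+T]∣N! : p ^ (N / p + suc T) ∣ N !
    p^[N/p+1+T]∣N! = p^[q+r]∣N! (m/n*n≤m N p)
      (subst (_≤ N / p) (m*n/n≡m (suc T * p) p) (/-monoˡ-≤ p [1+T]*p*p≤N))

    B+T<N/p+1+T : B + T < N / p + suc T
    B+T<N/p+1+T = subst (_≤ N / p + suc T) (+-suc B T) (+-monoˡ-≤ (suc T) B≤N/p)

2*n₀<p² : ∀ p .{{_ : NonZero p}} → 2 * n₀ p < p ^ 2
2*n₀<p² p = begin-strict
  2 * n₀ p       ≡⟨ *-comm 2 (n₀ p) ⟩
  n₀ p * 2       ≤⟨ m/n*n≤m (p ^ 2 ∸ 1) 2 ⟩
  p ^ 2 ∸ 1      <⟨ ∸-monoʳ-< z<s (>-nonZero⁻¹ (p ^ 2) {{m^n≢0 p 2}}) ⟩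
  p ^ 2          ∎
  where open ≤-Reasoning

n₀<n⇒p²≤2n : ∀ p {n} → n₀ p < n → p ^ 2 ≤ 2 * n
n₀<n⇒p²≤2n p {n} n₀<n = begin
  p ^ 2               ≤⟨ m≤n+m∸n (p ^ 2) 1 ⟩
  suc (p ^ 2 ∸ 1)     ≤⟨ m<[1+m/d]*d (p ^ 2 ∸ 1) 2 ⟩
  suc (n₀ p) * 2      ≤⟨ *-monoˡ-≤ 2 n₀<n ⟩
  n * 2               ≡⟨ *-comm n 2 ⟩
  2 * n               ∎
  where open ≤-Reasoning

odd⇒≢0 : ∀ {i} → i % 2 ≡ 1 → i ≢ 0
odd⇒≢0 () refl

theorem20 : (p n k : ℕ) → Prime p → p % 4 ≡ 3 →
    1 ≤ k → k ≤ n₀ p → n₀ p < n →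
    (λs : List ℕ) → sum λs ≡ 2 * n → length λs ≡ 2 * k →
    All (λ x → x % 2 ≡ 1 × x < p ^ 2 × x ≢ p) λs →
    ∃ λ q → (2 * n) ! ≡ q * denom n λs × p ∣ q
theorem20 p n k p-prime _ _ k≤n₀ n₀<n λs sum≡2n length≡2k parts =
  p∣N!/denominator (λ i → count i λs) (2 * n) (2 * n) count<p² admissible Σ≤2n
    (subst (_≤ 2 * n) p²≡p*p (n₀<n⇒p²≤2n p n₀<n))
  where
  open PrimeValuation p-prime

  p²≡p*p : p ^ 2 ≡ p * p
  p²≡p*p = cong (p *_) (*-identityʳ p)

  count<p² : ∀ i → count i λs < p * p
  count<p² i = begin-strict
    count i λs   ≤⟨ count≤length i λs ⟩
    length λs    ≡⟨ length≡2k ⟩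
    2 * k        ≤⟨ *-monoʳ-≤ 2 k≤n₀ ⟩
    2 * n₀ p     <⟨ 2*n₀<p² p ⟩
    p ^ 2        ≡⟨ p²≡p*p ⟩
    p * p        ∎
    where open ≤-Reasoning

  admissible : ∀ i → count i λs ≢ 0 → i ≢ 0 × i ≢ p × i < p * p
  admissible i count≢0 with count≢0⇒All i λs parts count≢0
  ... | odd , i<p² , i≢p = odd⇒≢0 odd , i≢p , subst (i <_) p²≡p*p i<p²

  Σ≤2n : sumFrom1 (2 * n) (λ i → count i λs * i) ≤ 2 * n
  Σ≤2n = subst (sumFrom1 (2 * n) (λ i → count i λs * i) ≤_) sum≡2n
    (sumFrom1-count≤sum (2 * n) λs)
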